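{- Let $n\ge1$ and let $\lambda$ be a strict partition. Then $\textsf{DecTab}_n(\lambda)$ (equivalently, $\textsf{DecTab}^+_n(\lambda)$) is nonempty if and only if $\lambda$ has at most $n$ nonzero parts.
   Context: For a strict partition $\lambda=(\lambda_1>\dots>\lambda_\ell>0)$ the shifted diagram is $\{(i,i+j-1):i\in[\ell],j\in[\lambda_i]\}$; row $i$ = boxes $(i,\cdot)$. A hook word is a sequence of positive integers $w_1\cdots w_k$ with $w_1\ge\dots\ge w_p<w_{p+1}<\dots<w_k$ for some $p\in[k]$; its middle element is $w_p$. A decomposition tableau of shape $\lambda$ assigns positive integers to the shifted diagram so that each row $\rho_i$ (read left to right) is a hook word and $\rho_i$ is a hook subword of maximal length in the concatenation $\rho_{i+1}\rho_i$ for each $i\in[\ell-1]$. A primed decomposition tableau is obtained by replacing the middle element $m$ by $m'$ in some subset of rows. $\textsf{DecTab}_n(\lambda)$ and $\textsf{DecTab}^+_n(\lambda)$ are the sets of decomposition tableaux, resp. primed decomposition tableaux, of shape $\lambda$ with all entries in $\{1'<1<\dots<n'<n\}$ (where $i'=i-\tfrac12$). -}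

module Defs where

open import Data.Nat using (ℕ; _≤_; _<_; _≥_; _>_)
open import Data.Bool using (Bool)
open import Data.List using (List; []; _∷_; _++_; _∷ʳ_; length; map)
open import Data.List.Relation.Unary.All using (All)
open import Data.List.Relation.Unary.Linked using (Linked)
open import Data.List.Relation.Binary.Pointwise using (Pointwise)
open import Data.List.Relation.Binary.Sublist.Propositional using (_⊆_)
open import Data.Product using (Σ; ∃; ∃-syntax; _×_)
open import Data.Sum using (_⊎_)
open import Relation.Binary.PropositionalEquality using (_≡_)

StrictPartition : List ℕ → Set
StrictPartition μ = Linked _>_ μ × All (λ k → 0 < k) μ

-- Hook word w = w₁ ⋯ w_k with w₁ ≥ ⋯ ≥ w_p < w_{p+1} < ⋯ < w_k.
-- A split  w ≡ d ++ m ∷ u  with (d ∷ʳ m) weakly decreasing and (m ∷ u)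
-- strictly increasing; m = w_p is the middle element.
HookSplit : List ℕ → List ℕ → ℕ → List ℕ → Set
HookSplit w d m u = (w ≡ d ++ m ∷ u) × Linked _≥_ (d ∷ʳ m) × Linked _<_ (m ∷ u)

IsHookWord : List ℕ → Set
IsHookWord w = All (λ x → 1 ≤ x) w × ∃[ d ] ∃[ m ] ∃[ u ] HookSplit w d m u

IsMaxHookSubword : List ℕ → List ℕ → Set
IsMaxHookSubword ρ v =
  ρ ⊆ v × IsHookWord ρ × (∀ σ → σ ⊆ v → IsHookWord σ → length σ ≤ length ρ)

-- A tableau on a shifted diagram of shape μ is given by its list of rows
-- ρ₁, ρ₂, …, ρ_ℓ (each read left to right); row i has μ_i boxes.
HasShape : List (List ℕ) → List ℕ → Set
HasShape rows μ = Pointwise (λ ρ k → length ρ ≡ k) rows μ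

IsDecTab : ℕ → List ℕ → List (List ℕ) → Set
IsDecTab n μ rows =
  HasShape rows μ
  × All (All (λ x → 1 ≤ x × x ≤ n)) rows
  × All IsHookWord rows
  × Linked (λ ρi ρi+1 → IsMaxHookSubword ρi (ρi+1 ++ ρi)) rows

DecTab : ℕ → List ℕ → Set
DecTab n μ = Σ (List (List ℕ)) (IsDecTab n μ)

data PEntry : Set where
  unp : ℕ → PEntry
  pr  : ℕ → PEntry

PrimedRow : List PEntry → List ℕ → Set
PrimedRow ρ' ρ =
  (ρ' ≡ map unp ρ)
  ⊎ (∃[ d ] ∃[ m ] ∃[ u ] HookSplit ρ d m u × (ρ' ≡ map unp d ++ pr m ∷ map unp u))

-- Primed decomposition tableau of shape μ with entries in {1' < 1 < … < n' < n}:
-- a decomposition tableau together with a choice of priming of middle elements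
-- in some subset of rows.
IsPrimedDecTab : ℕ → List ℕ → List (List PEntry) → Set
IsPrimedDecTab n μ rows' =
  ∃[ rows ] IsDecTab n μ rows × Pointwise PrimedRow rows' rows

DecTab⁺ : ℕ → List ℕ → Set
DecTab⁺ n μ = Σ (List (List PEntry)) (IsPrimedDecTab n μ)

{-# OPTIONS --safe #-}
module Submission where

open import Defs
open import Data.Nat using (ℕ; zero; suc; _+_; _≤_; _<_; _≥_; _>_; z≤n; s≤s; _≤?_)
open import Data.Nat.Properties
  using (≤-refl; ≤-trans; <⇒≤; <-irrefl; <⇒≱; ≰⇒>; n≤1+n; +-identityʳ; +-comm; module ≤-Reasoning)
open import Data.List using (List; []; _∷_; _++_; [_]; length; map; replicate)
open import Data.List.Properties using (length-++; length-replicate)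
open import Data.List.Relation.Unary.All as All using (All; []; _∷_)
open import Data.List.Relation.Unary.All.Properties using (replicate⁺)
open import Data.List.Relation.Unary.Linked using (Linked; []; [-]; _∷_)
open import Data.List.Relation.Binary.Pointwise using (Pointwise; []; _∷_; Pointwise-length)
open import Data.List.Relation.Binary.Sublist.Propositional using (_⊆_; []; _∷_; _∷ʳ_; ⊆-refl)
open import Data.List.Relation.Binary.Sublist.Propositional.Properties using (++⁺ˡ; length-mono-≤)
open import Data.Product using (_×_; _,_; proj₁; ∃₂)
open import Data.Sum using (inj₁)
open import Data.Empty using (⊥-elim)
open import Relation.Nullary using (yes; no)
open import Relation.Binary.PropositionalEquality using (_≡_; refl; sym; cong; cong₂; subst)
open import Function.Base using (_∘_)
open import Function.Bundles using (_⇔_; mk⇔)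

-- If ρᵢ = a ⋯ and ρᵢ₊₁ = b ⋯ with a ≤ b, then b ρᵢ is a longer hook subword of ρᵢ₊₁ρᵢ;
-- so the first entries of the rows strictly decrease downwards from at most n to at least 1,
-- forcing ℓ ≤ n.  Conversely, filling row i with the constant ℓ − i + 1 works: a hook
-- subword of c^{μᵢ₊₁} (c+1)^{μᵢ} cannot contain c (c+1) (c+1), so it is no longer than μᵢ.

data Hook : List ℕ → Set where
  ascending : ∀ {w} → Linked _<_ w → Hook w
  descend   : ∀ {x y w} → x ≥ y → Hook (y ∷ w) → Hook (x ∷ y ∷ w)

hookSplit⇒Hook : ∀ d m u → Linked _≥_ (d ++ [ m ]) → Linked _<_ (m ∷ u) → Hook (d ++ m ∷ u)
hookSplit⇒Hook []           m u _          asc = ascending asc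
hookSplit⇒Hook (x ∷ [])     m u (x≥m ∷ _)  asc = descend x≥m (ascending asc)
hookSplit⇒Hook (x ∷ y ∷ d)  m u (x≥y ∷ ds) asc = descend x≥y (hookSplit⇒Hook (y ∷ d) m u ds asc)

isHookWord⇒Hook : ∀ {w} → IsHookWord w → Hook w
isHookWord⇒Hook (_ , d , m , u , refl , desc , asc) = hookSplit⇒Hook d m u desc asc

Hook-∷⁻ : ∀ {x w} → Hook (x ∷ w) → Hook w
Hook-∷⁻ (ascending [-])       = ascending []
Hook-∷⁻ (ascending (_ ∷ asc)) = ascending asc
Hook-∷⁻ (descend _ h)         = h

Hook-replicate⁻ : ∀ p {x w} → Hook (replicate (suc p) x ++ w) → Hook (x ∷ w)
Hook-replicate⁻ zero    h = h
Hook-replicate⁻ (suc p) h = Hook-replicate⁻ p (Hook-∷⁻ h)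

Hook-ascent⇒ascent : ∀ {x y z w} → Hook (x ∷ y ∷ z ∷ w) → x < y → y < z
Hook-ascent⇒ascent (ascending (_ ∷ y<z ∷ _)) _   = y<z
Hook-ascent⇒ascent (descend x≥y _)           x<y = ⊥-elim (<⇒≱ x<y x≥y)

isHookWord-∷⁺ : ∀ {a b w} → 1 ≤ b → a ≤ b → IsHookWord (a ∷ w) → IsHookWord (b ∷ a ∷ w)
isHookWord-∷⁺ 1≤b a≤b (pos , []    , _ , u , refl , _    , asc) =
  1≤b ∷ pos , [ _ ] , _ , u , refl , a≤b ∷ [-] , asc
isHookWord-∷⁺ 1≤b a≤b (pos , x ∷ d , m , u , refl , desc , asc) =
  1≤b ∷ pos , _ ∷ x ∷ d , m , u , refl , a≤b ∷ desc , asc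

replicate-∷ʳ : ∀ j (v : ℕ) → replicate (suc j) v ≡ replicate j v ++ [ v ]
replicate-∷ʳ zero    v = refl
replicate-∷ʳ (suc j) v = cong (v ∷_) (replicate-∷ʳ j v)

Linked-≥-replicate : ∀ k (v : ℕ) → Linked _≥_ (replicate k v)
Linked-≥-replicate zero          v = []
Linked-≥-replicate (suc zero)    v = [-]
Linked-≥-replicate (suc (suc k)) v = ≤-refl ∷ Linked-≥-replicate (suc k) v

isHookWord-replicate : ∀ j {v} → 1 ≤ v → IsHookWord (replicate (suc j) v)
isHookWord-replicate j {v} 1≤v =
  replicate⁺ (suc j) 1≤v , replicate j v , v , [] , replicate-∷ʳ j v ,
  subst (Linked _≥_) (replicate-∷ʳ j v) (Linked-≥-replicate (suc j) v) , [-]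

⊆-++⁻ : ∀ (xs : List ℕ) {ys σ} → σ ⊆ xs ++ ys →
  ∃₂ λ σ₁ σ₂ → σ₁ ⊆ xs × σ₂ ⊆ ys × σ ≡ σ₁ ++ σ₂
⊆-++⁻ []       τ = [] , _ , [] , τ , refl
⊆-++⁻ (x ∷ xs) (.x ∷ʳ τ) with ⊆-++⁻ xs τ
... | σ₁ , σ₂ , τ₁ , τ₂ , eq = σ₁ , σ₂ , x ∷ʳ τ₁ , τ₂ , eq
⊆-++⁻ (x ∷ xs) (refl ∷ τ) with ⊆-++⁻ xs τ
... | σ₁ , σ₂ , τ₁ , τ₂ , eq = x ∷ σ₁ , σ₂ , refl ∷ τ₁ , τ₂ , cong (x ∷_) eq

⊆-replicate⁻ : ∀ {n} {x : ℕ} {σ} → σ ⊆ replicate n x → σ ≡ replicate (length σ) x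
⊆-replicate⁻ {zero}  []          = refl
⊆-replicate⁻ {suc n} (_ ∷ʳ τ)    = ⊆-replicate⁻ τ
⊆-replicate⁻ {suc n} (refl ∷ τ)  = cong (_ ∷_) (⊆-replicate⁻ τ)

length-⊆-replicate : ∀ {n} {x : ℕ} {σ} → σ ⊆ replicate n x → length σ ≤ n
length-⊆-replicate {n} τ = subst (_ ≤_) (length-replicate n) (length-mono-≤ τ)

_◁_ : List ℕ → List ℕ → Set
ρ ◁ ρ′ = IsMaxHookSubword ρ (ρ′ ++ ρ)

◁-head< : ∀ {a b ρ σ} → 1 ≤ b → (a ∷ ρ) ◁ (b ∷ σ) → b < a
◁-head< {a} {b} {ρ} {σ} 1≤b (_ , hook , maximal) with a ≤? b
... | no a≰b  = ≰⇒> a≰b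
... | yes a≤b = ⊥-elim (<-irrefl refl
      (maximal (b ∷ a ∷ ρ) (refl ∷ ++⁺ˡ σ ⊆-refl) (isHookWord-∷⁺ 1≤b a≤b hook)))

length<head : ∀ {a ρ rows μ} → HasShape rows μ → All (0 <_) μ → All (All (1 ≤_)) rows →
  1 ≤ a → Linked _◁_ ((a ∷ ρ) ∷ rows) → length rows < a
length<head [] _ _ 1≤a _ = 1≤a
length<head {rows = [] ∷ _} (refl ∷ _) (() ∷ _) _ _ _
length<head (_ ∷ shape) (_ ∷ pos) ((1≤b ∷ _) ∷ ents) _ (ρ◁σ ∷ links) =
  ≤-trans (s≤s (length<head shape pos ents 1≤b links)) (◁-head< 1≤b ρ◁σ)

decTab⇒length≤ : ∀ {n μ} → All (0 <_) μ → DecTab n μ → length μ ≤ n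
decTab⇒length≤ {μ = []}  _          _ = z≤n
decTab⇒length≤ (() ∷ _) ([] ∷ _ , (refl ∷ _) , _)
decTab⇒length≤ {n} {μ} (_ ∷ pos)
  ((a ∷ ρ) ∷ rows , shape@(_ ∷ shape′) , ((1≤a , a≤n) ∷ _) ∷ ents , _ , links) =
  begin
    length μ           ≡⟨ sym (Pointwise-length shape) ⟩
    suc (length rows)  ≤⟨ length<head shape′ pos (All.map (All.map proj₁) ents) 1≤a links ⟩
    a                  ≤⟨ a≤n ⟩
    n                  ∎
  where open ≤-Reasoning

hook-replicate-length≤ : ∀ {c k′ k} p q → p ≤ k′ → q ≤ k → k′ < k →
  Hook (replicate p c ++ replicate q (suc c)) → p + q ≤ k
hook-replicate-length≤ zero          q             _   q≤k _    _ = q≤k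
hook-replicate-length≤ p             zero          p≤k′ _  k′<k _
  rewrite +-identityʳ p = ≤-trans p≤k′ (<⇒≤ k′<k)
hook-replicate-length≤ p             (suc zero)    p≤k′ _  k′<k _
  rewrite +-comm p 1 = ≤-trans (s≤s p≤k′) k′<k
hook-replicate-length≤ (suc p)   (suc (suc q)) _    _  _    h =
  ⊥-elim (<-irrefl refl (Hook-ascent⇒ascent (Hook-replicate⁻ p h) ≤-refl))

replicate-◁ : ∀ {c k′ k} → k′ < k → replicate k (suc c) ◁ replicate k′ c
replicate-◁ {c} {k′} {suc j} k′<k =
  ++⁺ˡ (replicate k′ c) ⊆-refl , isHookWord-replicate j (s≤s z≤n) , maximal
  where
  maximal : ∀ σ → σ ⊆ replicate k′ c ++ replicate (suc j) (suc c) → IsHookWord σ →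
    length σ ≤ length (replicate (suc j) (suc c))
  maximal σ τ hook with ⊆-++⁻ (replicate k′ c) τ
  ... | σ₁ , σ₂ , τ₁ , τ₂ , refl =
    begin
      length (σ₁ ++ σ₂)          ≡⟨ length-++ σ₁ ⟩
      length σ₁ + length σ₂      ≤⟨ hook-replicate-length≤ (length σ₁) (length σ₂)
                                      (length-⊆-replicate τ₁) (length-⊆-replicate τ₂) k′<k
                                      (subst Hook (cong₂ _++_ (⊆-replicate⁻ τ₁) (⊆-replicate⁻ τ₂))
                                        (isHookWord⇒Hook hook)) ⟩
      suc j                      ≡⟨ sym (length-replicate (suc j)) ⟩
      length (replicate (suc j) (suc c)) ∎
    where open ≤-Reasoning

constantRows : List ℕ → List (List ℕ)
constantRows []      = []
constantRows (k ∷ μ) = replicate k (suc (length μ)) ∷ constantRows μ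

constantRows-isDecTab : ∀ {n μ} → StrictPartition μ → length μ ≤ n → IsDecTab n μ (constantRows μ)
constantRows-isDecTab {n} {μ} (decreasing , positive) μ≤n =
  shape μ , entries μ μ≤n , hooks μ positive , links μ decreasing
  where
  shape : ∀ μ → HasShape (constantRows μ) μ
  shape []      = []
  shape (k ∷ μ) = length-replicate k ∷ shape μ

  entries : ∀ μ → length μ ≤ n → All (All (λ x → 1 ≤ x × x ≤ n)) (constantRows μ)
  entries []      _   = []
  entries (k ∷ μ) μ≤n = replicate⁺ k (s≤s z≤n , μ≤n) ∷ entries μ (≤-trans (n≤1+n _) μ≤n)

  hooks : ∀ μ → All (0 <_) μ → All IsHookWord (constantRows μ)
  hooks []          _         = []
  hooks (suc j ∷ μ) (_ ∷ pos) = isHookWord-replicate j (s≤s z≤n) ∷ hooks μ pos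

  links : ∀ μ → Linked _>_ μ → Linked _◁_ (constantRows μ)
  links []          _           = []
  links (_ ∷ [])    _           = [-]
  links (_ ∷ _ ∷ μ) (k>k′ ∷ dec) = replicate-◁ k>k′ ∷ links (_ ∷ μ) dec

length≤⇒decTab : ∀ {n μ} → StrictPartition μ → length μ ≤ n → DecTab n μ
length≤⇒decTab {μ = μ} sp μ≤n = constantRows μ , constantRows-isDecTab sp μ≤n

decTab⇒decTab⁺ : ∀ {n μ} → DecTab n μ → DecTab⁺ n μ
decTab⇒decTab⁺ (rows , isDecTab) = map (map unp) rows , rows , isDecTab , unprimed rows
  where
  unprimed : ∀ rows → Pointwise PrimedRow (map (map unp) rows) rows
  unprimed []         = []
  unprimed (_ ∷ rows) = inj₁ refl ∷ unprimed rows

decTab⁺⇒decTab : ∀ {n μ} → DecTab⁺ n μ → DecTab n μ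
decTab⁺⇒decTab (_ , rows , isDecTab , _) = rows , isDecTab

mainTheorem10 : (n : ℕ) → 1 ≤ n → (μ : List ℕ) → StrictPartition μ →
    (DecTab n μ ⇔ length μ ≤ n) × (DecTab⁺ n μ ⇔ length μ ≤ n)
mainTheorem10 n _ μ sp@(_ , positive) =
  mk⇔ (decTab⇒length≤ positive) (length≤⇒decTab sp) ,
  mk⇔ (decTab⇒length≤ positive ∘ decTab⁺⇒decTab) (decTab⇒decTab⁺ ∘ length≤⇒decTab sp)
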